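{- Let $T$ be a pruned set-theoretic binary tree. Then $T$ admits a $\Sigma$-coloring if and only if $T$ has a branch containing infinitely many $1$s (i.e., $T \notin F$).
   Context: Let $2^{<\infty}$ be the set of finite sequences of $0$s and $1$s. A set-theoretic binary tree is a nonempty $T\subseteq 2^{<\infty}$ closed under initial segments; it is viewed as a rooted tree whose root is the empty sequence and in which the parent of $a_0\ldots a_k$ is $a_0\ldots a_{k-1}$. For $s\in T$, $s^\frown 0$ (if in $T$) is the left child and $s^\frown 1$ (if in $T$) is the right child of $s$. $T$ is pruned if every $s\in T$ has at least one child. A branch of $T$ is an infinite binary sequence $\beta\in 2^{\mathbb{N}}$ all of whose finite initial segments lie in $T$. $F$ denotes the set of pruned binary trees all of whose branches contain only finitely many $1$s. A $\Sigma$-coloring of $T$ is a function $f\colon T\to\mathbb{N}$ such that: (1) if $x$ is the root then $f(x)\ge 1$; (2) if $f(x)=1$ then $x$ has a right child $y$ with $f(y)\ge 1$; (3) if $f(x)\ge 2$ then $x$ has a left child $y$ with $f(y)=f(x)-1$. -}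

module Defs where

open import Data.Bool using (Bool; true; false)
open import Data.Nat using (ℕ; zero; suc; _≤_)
open import Data.List using (List; []; _∷_; _++_; [_])
open import Data.Product using (Σ; Σ-syntax; ∃; ∃-syntax; _×_)
open import Data.Sum using (_⊎_)
open import Relation.Binary.PropositionalEquality using (_≡_)

-- Finite 0/1 sequences: lists of Bool, with 0 = false, 1 = true.
-- A sequence a₀…a_k is the list a₀ ∷ … ∷ a_k ∷ []; children are obtained
-- by appending at the end: s ⌢ b = s ++ [ b ].
Seq : Set
Seq = List Bool

_⌢_ : Seq → Bool → Seq
s ⌢ b = s ++ [ b ]

record IsTree (T : Seq → Set) : Set where
  field
    nonempty : ∃[ s ] T s
    prefix-closed : ∀ s t → T (s ++ t) → T s

IsPruned : (T : Seq → Set) → Set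
IsPruned T = ∀ s → T s → T (s ⌢ false) ⊎ T (s ⌢ true)

initSeg : (ℕ → Bool) → ℕ → Seq
initSeg β zero = []
initSeg β (suc n) = initSeg β n ⌢ β n

IsBranch : (T : Seq → Set) → (ℕ → Bool) → Set
IsBranch T β = ∀ n → T (initSeg β n)

InfinitelyManyOnes : (ℕ → Bool) → Set
InfinitelyManyOnes β = ∀ n → ∃[ m ] (n ≤ m × β m ≡ true)

record IsΣColoring (T : Seq → Set) (f : (s : Seq) → T s → ℕ) : Set where
  field
    root  : (p : T []) → 1 ≤ f [] p
    right : ∀ s (p : T s) → f s p ≡ 1 →
            Σ[ q ∈ T (s ⌢ true) ] 1 ≤ f (s ⌢ true) q
    left  : ∀ s (p : T s) → 2 ≤ f s p →
            Σ[ q ∈ T (s ⌢ false) ] suc (f (s ⌢ false) q) ≡ f s p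

HasΣColoring : (T : Seq → Set) → Set
HasΣColoring T = Σ[ f ∈ ((s : Seq) → T s → ℕ) ] IsΣColoring T f

-- Write g n for the number of 0s of β from position n up to its next 1.
-- Along a branch with infinitely many 1s, colouring each node s of the branch by
-- 1 + g (length s) (and every other node by 0) is a Σ-colouring: colour 1 means the
-- branch goes right next, colour c ≥ 2 means it goes left to a node of colour c - 1.
-- Conversely, starting at the root and always moving to the child promised by a
-- Σ-colouring yields a branch on which colour - 1 is exactly this distance g, so
-- from every position a 1 is at most g n steps away.
module Submission where

open import Defs
open import Data.Bool using (Bool; true; false; _≟_)
open import Data.Empty using (⊥-elim)
open import Data.List using ([]; length)
open import Data.List.Properties using (≡-dec; length-++)
open import Data.Nat using (ℕ; zero; suc; _+_; _∸_; _≤_; _<_; z≤n; s≤s)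
open import Data.Nat.Properties using (≤-refl; <⇒≤; ≤-trans; +-comm; +-suc; +-identityʳ; m∸n≤m; m+[n∸m]≡n; suc-injective)
open import Data.Product using (Σ-syntax; ∃-syntax; _×_; _,_; proj₁; proj₂)
open import Function.Bundles using (_⇔_; mk⇔)
open import Relation.Nullary using (yes; no)
open import Relation.Binary.PropositionalEquality using (_≡_; refl; sym; trans; cong; subst; module ≡-Reasoning)

length-initSeg : ∀ β n → length (initSeg β n) ≡ n
length-initSeg β zero = refl
length-initSeg β (suc n) =
  trans (length-++ (initSeg β n)) (trans (cong (_+ 1) (length-initSeg β n)) (+-comm n 1))

-- DistanceStep c b c' : a position reading b is c steps before the next 1,
-- and the following position is c' steps before it.
data DistanceStep : ℕ → Bool → ℕ → Set where
  at-one     : ∀ {c'} → DistanceStep 0 true c'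
  before-one : ∀ {c'} → DistanceStep (suc c') false c'

at-one-inv : ∀ {c b c'} → DistanceStep c b c' → c ≡ 0 → b ≡ true
at-one-inv at-one _ = refl

before-one-inv : ∀ {c b c' k} → DistanceStep c b c' → c ≡ suc k → b ≡ false × c' ≡ k
before-one-inv before-one refl = refl , refl

IsDistanceToNextOne : (ℕ → Bool) → (ℕ → ℕ) → Set
IsDistanceToNextOne β g = ∀ n → DistanceStep (g n) (β n) (g (suc n))

distanceToNextOne⇒infinitelyManyOnes : ∀ {β g} → IsDistanceToNextOne β g → InfinitelyManyOnes β
distanceToNextOne⇒infinitelyManyOnes {β} {g} step n = oneWithin (g n) n refl
  where
  oneWithin : ∀ k n → g n ≡ k → ∃[ m ] (n ≤ m × β m ≡ true)
  oneWithin zero n gn≡0 = n , ≤-refl , at-one-inv (step n) gn≡0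
  oneWithin (suc k) n gn≡1+k with oneWithin k (suc n) (proj₂ (before-one-inv (step n) gn≡1+k))
  ... | m , n<m , βm≡1 = m , <⇒≤ n<m , βm≡1

module DistanceToNextOne (β : ℕ → Bool) where

  distanceStep : Bool → ℕ → ℕ
  distanceStep true  _ = 0
  distanceStep false c = suc c

  -- Counts the 0s from position n up to the next 1, but truncated after `fuel` positions.
  zeroRun : (fuel n : ℕ) → ℕ
  zeroRun zero       n = 0
  zeroRun (suc fuel) n = distanceStep (β n) (zeroRun fuel (suc n))

  OneWithin : ℕ → ℕ → Set
  OneWithin n k = ∃[ j ] (j < k × β (n + j) ≡ true)

  oneWithin-suc : ∀ {n k} → β n ≡ false → OneWithin n (suc k) → OneWithin (suc n) k
  oneWithin-suc {n} βn≡0 (zero , _ , βn+0≡1)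
    with trans (sym βn≡0) (trans (cong β (sym (+-identityʳ n))) βn+0≡1)
  ... | ()
  oneWithin-suc {n} _ (suc j , s≤s j<k , βn+1+j≡1) = j , j<k , trans (cong β (sym (+-suc n j))) βn+1+j≡1

  zeroRun-fuel-irrelevant : ∀ k k' n → OneWithin n k → OneWithin n k' → zeroRun k n ≡ zeroRun k' n
  zeroRun-fuel-irrelevant zero _ _ (_ , () , _) _
  zeroRun-fuel-irrelevant (suc k) zero _ _ (_ , () , _)
  zeroRun-fuel-irrelevant (suc k) (suc k') n w w' with β n in βn≡b
  ... | true  = refl
  ... | false = cong suc (zeroRun-fuel-irrelevant k k' (suc n) (oneWithin-suc βn≡b w) (oneWithin-suc βn≡b w'))

  distanceStep-step : ∀ b c c' → (b ≡ false → c ≡ c') → DistanceStep (distanceStep b c) b c'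
  distanceStep-step true  _ _ _ = at-one
  distanceStep-step false c c' c≡c' with c≡c' refl
  ... | refl = before-one

  module _ (ones : InfinitelyManyOnes β) where

    horizon : ℕ → ℕ
    horizon n = suc (proj₁ (ones n))

    oneWithin-horizon : ∀ n → OneWithin n (horizon n)
    oneWithin-horizon n with ones n
    ... | m , n≤m , βm≡1 = m ∸ n , s≤s (m∸n≤m m n) , trans (cong β (m+[n∸m]≡n n≤m)) βm≡1

    distance : ℕ → ℕ
    distance n = zeroRun (horizon n) n

    distance-isDistanceToNextOne : IsDistanceToNextOne β distance
    distance-isDistanceToNextOne n = distanceStep-step (β n) _ _ λ βn≡0 →
      zeroRun-fuel-irrelevant _ _ (suc n) (oneWithin-suc βn≡0 (oneWithin-horizon n)) (oneWithin-horizon (suc n))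

infinitelyManyOnes⇒distanceToNextOne : ∀ {β} → InfinitelyManyOnes β → ∃[ g ] IsDistanceToNextOne β g
infinitelyManyOnes⇒distanceToNextOne {β} ones = distance ones , distance-isDistanceToNextOne ones
  where open DistanceToNextOne β

module ColouringAlongBranch (T : Seq → Set) {β : ℕ → Bool} (branch : IsBranch T β)
                            {g : ℕ → ℕ} (step : IsDistanceToNextOne β g) where

  colour : Seq → ℕ
  colour s with ≡-dec _≟_ s (initSeg β (length s))
  ... | yes _ = suc (g (length s))
  ... | no  _ = 0

  colour-initSeg : ∀ n → colour (initSeg β n) ≡ suc (g n)
  colour-initSeg n with ≡-dec _≟_ (initSeg β n) (initSeg β (length (initSeg β n)))
  ... | yes _ = cong (λ k → suc (g k)) (length-initSeg β n)
  ... | no ≢ = ⊥-elim (≢ (cong (initSeg β) (sym (length-initSeg β n))))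

  positive⇒onBranch : ∀ s → 1 ≤ colour s → ∃[ n ] s ≡ initSeg β n
  positive⇒onBranch s _ with ≡-dec _≟_ s (initSeg β (length s))
  positive⇒onBranch s _   | yes s≡ = length s , s≡
  positive⇒onBranch s ()  | no _

  child-inT : ∀ {n b} → β n ≡ b → T (initSeg β n ⌢ b)
  child-inT {n} refl = branch (suc n)

  colour-child : ∀ {n b} → β n ≡ b → colour (initSeg β n ⌢ b) ≡ suc (g (suc n))
  colour-child {n} refl = colour-initSeg (suc n)

  isΣColouring : IsΣColoring T (λ s _ → colour s)
  isΣColouring = record
    { root  = λ _ → s≤s z≤n
    ; right = right
    ; left  = left
    }
    where
    right : ∀ s (p : T s) → colour s ≡ 1 → Σ[ q ∈ T (s ⌢ true) ] 1 ≤ colour (s ⌢ true)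
    right s _ c≡1 with positive⇒onBranch s (subst (1 ≤_) (sym c≡1) (s≤s z≤n))
    ... | n , refl = child-inT βn≡1 , subst (1 ≤_) (sym (colour-child βn≡1)) (s≤s z≤n)
      where
      βn≡1 : β n ≡ true
      βn≡1 = at-one-inv (step n) (suc-injective (trans (sym (colour-initSeg n)) c≡1))

    left : ∀ s (p : T s) → 2 ≤ colour s → Σ[ q ∈ T (s ⌢ false) ] suc (colour (s ⌢ false)) ≡ colour s
    left s _ 2≤c with positive⇒onBranch s (≤-trans (s≤s z≤n) 2≤c)
    ... | n , refl with g n in gn≡ | subst (2 ≤_) (colour-initSeg n) 2≤c
    ... | zero  | s≤s ()
    ... | suc k | _ with before-one-inv (step n) gn≡
    ... | βn≡0 , gn+1≡k = child-inT βn≡0 , (begin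
      suc (colour (initSeg β n ⌢ false)) ≡⟨ cong suc (colour-child βn≡0) ⟩
      suc (suc (g (suc n)))              ≡⟨ cong (λ c → suc (suc c)) gn+1≡k ⟩
      suc (suc k)                        ≡⟨ cong suc gn≡ ⟨
      suc (g n)                          ≡⟨ colour-initSeg n ⟨
      colour (initSeg β n)               ∎)
      where open ≡-Reasoning

branchWithDistance⇒hasΣColouring : ∀ T {β g} → IsBranch T β → IsDistanceToNextOne β g → HasΣColoring T
branchWithDistance⇒hasΣColouring T branch step = (λ s _ → colour s) , isΣColouring
  where open ColouringAlongBranch T branch step

module WalkAlongColouring (T : Seq → Set) {f : (s : Seq) → T s → ℕ} (colouring : IsΣColoring T f)
                          (root∈T : T []) where
  open IsΣColoring colouring

  record LitNode : Set where
    constructor lit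
    field
      node   : Seq
      inT    : T node
      level  : ℕ
      colour : f node inT ≡ suc level
  open LitNode

  positive : ∀ {n} → 1 ≤ n → ∃[ c ] n ≡ suc c
  positive {suc c} _ = c , refl

  start : LitNode
  start = lit [] root∈T (proj₁ (positive (root root∈T))) (proj₂ (positive (root root∈T)))

  record Move (x : LitNode) : Set where
    field
      direction : Bool
      target    : LitNode
      isChild   : node target ≡ node x ⌢ direction
      distance  : DistanceStep (level x) direction (level target)
  open Move

  move : ∀ x → Move x
  move (lit s p zero f≡1) with right s p f≡1
  ... | q , 1≤fq = record
    { direction = true
    ; target    = lit (s ⌢ true) q (proj₁ (positive 1≤fq)) (proj₂ (positive 1≤fq))
    ; isChild   = refl
    ; distance  = at-one
    }
  move (lit s p (suc c) f≡2+c) with left s p (subst (2 ≤_) (sym f≡2+c) (s≤s (s≤s z≤n)))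
  ... | q , 1+fq≡f = record
    { direction = false
    ; target    = lit (s ⌢ false) q c (suc-injective (trans 1+fq≡f f≡2+c))
    ; isChild   = refl
    ; distance  = before-one
    }

  walk : ℕ → LitNode
  walk zero    = start
  walk (suc n) = target (move (walk n))

  path : ℕ → Bool
  path n = direction (move (walk n))

  walk-initSeg : ∀ n → node (walk n) ≡ initSeg path n
  walk-initSeg zero    = refl
  walk-initSeg (suc n) = trans (isChild (move (walk n))) (cong (_⌢ path n) (walk-initSeg n))

  path-isBranch : IsBranch T path
  path-isBranch n = subst T (walk-initSeg n) (inT (walk n))

  level-isDistanceToNextOne : IsDistanceToNextOne path (λ n → level (walk n))
  level-isDistanceToNextOne n = distance (move (walk n))

hasΣColouring⇒branchWithDistance : ∀ T → T [] → HasΣColoring T →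
  Σ[ β ∈ (ℕ → Bool) ] (IsBranch T β × ∃[ g ] IsDistanceToNextOne β g)
hasΣColouring⇒branchWithDistance T root∈T (_ , colouring) =
  path , path-isBranch , (λ n → LitNode.level (walk n)) , level-isDistanceToNextOne
  where open WalkAlongColouring T colouring root∈T

lemma2p2 : (T : Seq → Set) → IsTree T → IsPruned T →
    HasΣColoring T ⇔ (Σ[ β ∈ (ℕ → Bool) ] (IsBranch T β × InfinitelyManyOnes β))
lemma2p2 T tree _ = mk⇔ colouring⇒branch branch⇒colouring
  where
  root∈T : T []
  root∈T = IsTree.prefix-closed tree [] _ (proj₂ (IsTree.nonempty tree))

  colouring⇒branch : HasΣColoring T → Σ[ β ∈ (ℕ → Bool) ] (IsBranch T β × InfinitelyManyOnes β)
  colouring⇒branch colouring with hasΣColouring⇒branchWithDistance T root∈T colouring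
  ... | β , branch , _ , step = β , branch , distanceToNextOne⇒infinitelyManyOnes step

  branch⇒colouring : Σ[ β ∈ (ℕ → Bool) ] (IsBranch T β × InfinitelyManyOnes β) → HasΣColoring T
  branch⇒colouring (_ , branch , ones) with infinitelyManyOnes⇒distanceToNextOne ones
  ... | _ , step = branchWithDistance⇒hasΣColouring T branch step
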